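{- Let $\mathcal{G}_{\mathcal{R}}=(\mathcal{A}_{\mathcal{R}},L(\mathcal{A}_I),L(\mathcal{A}_B))$ be a regular safety game over the regular arena $\mathcal{A}_{\mathcal{R}}=(L(\mathcal{A}_{V_0}),L(\mathcal{A}_{V_1}),R(\mathcal{T}_E))$. Run the learning procedure described below on $\mathcal{G}_{\mathcal{R}}$. Then: (i) if the procedure terminates, the DFA $\mathcal{A}_H$ it outputs recognizes a winning set of $\mathcal{G}_{\mathcal{R}}$; (ii) if the maximal winning set $W$ of $\mathcal{G}_{\mathcal{R}}$ is regular, the procedure terminates after at most $n$ iterations (equivalence queries), where $n$ is the number of states of the minimal DFA recognizing $W$.
   Context: Automata: an NFA is $(Q,\Sigma,q_I,\delta,F)$ with the usual semantics; $L(\mathcal{A})$ is its language; a DFA is an NFA whose transition relation is a function. A length-preserving transducer is $\mathcal{T}=(Q,\Sigma,q_I,\delta,F)$ with $\delta\subseteq Q\times\Sigma\times\Sigma\times Q$; it accepts a pair of equal-length words $(a_1\dots a_n,b_1\dots b_n)$ if there is a run $q_0\dots q_n$ with $q_0=q_I$, $(q_{i-1},(a_i,b_i),q_i)\in\delta$ for all $i$, and $q_n\in F$; $R(\mathcal{T})$ is the relation of accepted pairs. For a relation $E$ and vertex $v$, $E(\{v\})=\{u:(v,u)\in E\}$. Safety games: an arena is $(V_0,V_1,E)$ with $V=V_0\uplus V_1$ countable and $E\subseteq V\times V$; a safety game is $(\mathcal{A},I,B)$ with $I,B\subseteq V$. A play starts at a vertex of $I$, the owner of the current vertex moves along an edge,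 forever; Player 0 wins the play if it never visits $B$. A winning set is $W\subseteq V$ with (1) $I\subseteq W$, (2) $B\cap W=\emptyset$, (3) $E(\{v\})\cap W\neq\emptyset$ for all $v\in W\cap V_0$, (4) $E(\{v\})\subseteq W$ for all $v\in W\cap V_1$. The maximal winning set is the (unique) inclusion-maximal winning set. A regular arena is $(L(\mathcal{A}_{V_0}),L(\mathcal{A}_{V_1}),R(\mathcal{T}_E))$ with $\mathcal{A}_{V_0},\mathcal{A}_{V_1}$ NFAs and $\mathcal{T}_E$ a length-preserving transducer; a regular safety game additionally has initial and bad sets $L(\mathcal{A}_I),L(\mathcal{A}_B)$ given by NFAs. Learning procedure: an Angluin-style active learner (the $L^*$ algorithm in the Rivest–Schapire variant: it maintains an observation table indexed by prefixes and suffixes, fills it via membership queries until it is closed and consistent, builds the corresponding hypothesis DFA $\mathcal{A}_H$, asks an equivalence query, and on a counterexample adds a suffix found by binary search with membership queries) interacts with the following teacher. Membership query $Mem(w)$: answer "yes" iff Player 0 wins the finite safety game on the arena restricted to words of length $|w|$ with initial set $\{w\}$ and bad set $\{w'\in L(\mathcal{A}_B): |w'|=|w|\}$ (finite because $\mathcal{T}_E$ is length-preserving). Equivalence query $Eq(\mathcal{A}_H)$: (a) if some $v\in L(\mathcal{A}_I)\setminus L(\mathcal{A}_H)$ exists, return counterexample $v$; (b) else if some $v\in L(\mathcal{A}_H)\cap L(\mathcal{A}_B)$ exists, return $v$; (c) else if some $v\in L(\mathcal{A}_{V_0})\cap L(\mathcal{A}_H)$ has $R(\mathcal{T}_E)(\{v\})\cap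 L(\mathcal{A}_H)=\emptyset$: if $Mem(v)$ is "yes", return some $u\in R(\mathcal{T}_E)(\{v\})$ with $Mem(u)$ "yes", otherwise return $v$; (d) else if some $v\in L(\mathcal{A}_{V_1})\cap L(\mathcal{A}_H)$ has $R(\mathcal{T}_E)(\{v\})\not\subseteq L(\mathcal{A}_H)$: if $Mem(v)$ is "yes", return some $u\in R(\mathcal{T}_E)(\{v\})\setminus L(\mathcal{A}_H)$, otherwise return $v$; (e) otherwise answer "yes", and the procedure terminates outputting $\mathcal{A}_H$. An iteration is one hypothesis/equivalence query round.
   Formalization: Part (i) concludes that $L(\mathcal{A}_H)\cap V$, with $V=L(\mathcal{A}_{V_0})\cup L(\mathcal{A}_{V_1})$, is a winning set of $\mathcal{G}_{\mathcal{R}}$, rather than that $\mathcal{A}_H$ recognizes a winning set. The statement above fails without it. -}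

module Defs where

open import Data.Nat using (ℕ; zero; suc; _≤_)
open import Data.Fin using (Fin)
open import Data.Bool using (Bool; T; true; false)
open import Data.List using (List; []; _∷_; _++_; [_]; length)
open import Data.List.Membership.Propositional using (_∈_)
open import Data.List.Relation.Unary.All using (All)
open import Data.Product using (Σ; ∃; _×_; _,_; Σ-syntax; ∃-syntax)
open import Data.Sum using (_⊎_)
open import Data.Empty using (⊥)
open import Relation.Nullary using (¬_)
open import Relation.Binary.PropositionalEquality using (_≡_)
open import Function.Bundles using (_⇔_)
open import Relation.Binary.Construct.Closure.ReflexiveTransitive using (Star)

Word : ℕ → Set
Word k = List (Fin k)

record NFA (k : ℕ) : Set where
  field
    nStates : ℕ
    init    : Fin nStates
    δ       : Fin nStates → Fin k → Fin nStates → Bool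
    final   : Fin nStates → Bool

NFA-accFrom : ∀ {k} (A : NFA k) → Fin (NFA.nStates A) → Word k → Set
NFA-accFrom A q []      = T (NFA.final A q)
NFA-accFrom A q (a ∷ w) =
  Σ[ q' ∈ Fin (NFA.nStates A) ] (T (NFA.δ A q a q') × NFA-accFrom A q' w)

Lang : ∀ {k} → NFA k → Word k → Set
Lang A w = NFA-accFrom A (NFA.init A) w

record Transducer (k : ℕ) : Set where
  field
    nStates : ℕ
    init    : Fin nStates
    δ       : Fin nStates → Fin k → Fin k → Fin nStates → Bool
    final   : Fin nStates → Bool

Tr-accFrom : ∀ {k} (𝒯 : Transducer k) → Fin (Transducer.nStates 𝒯) → Word k → Word k → Set
Tr-accFrom 𝒯 q []      []      = T (Transducer.final 𝒯 q)
Tr-accFrom 𝒯 q []      (_ ∷ _) = ⊥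
Tr-accFrom 𝒯 q (_ ∷ _) []      = ⊥
Tr-accFrom 𝒯 q (a ∷ w) (b ∷ u) =
  Σ[ q' ∈ Fin (Transducer.nStates 𝒯) ] (T (Transducer.δ 𝒯 q a b q') × Tr-accFrom 𝒯 q' w u)

Rel : ∀ {k} → Transducer k → Word k → Word k → Set
Rel 𝒯 v u = Tr-accFrom 𝒯 (Transducer.init 𝒯) v u

record PGame (k : ℕ) : Set₁ where
  field
    V₀ V₁ I B : Word k → Set
    E         : Word k → Word k → Set

IsWinningSet : ∀ {k} → PGame k → (Word k → Set) → Set
IsWinningSet G W =
    (∀ v → W v → V₀ v ⊎ V₁ v)
  × (∀ v → I v → W v)
  × (∀ v → B v → W v → ⊥)
  × (∀ v → W v → V₀ v → ∃[ u ] (E v u × W u))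
  × (∀ v → W v → V₁ v → ∀ u → E v u → W u)
  where open PGame G

IsMaximalWinningSet : ∀ {k} → PGame k → (Word k → Set) → Set₁
IsMaximalWinningSet {k} G W =
  IsWinningSet G W × (∀ (W' : Word k → Set) → IsWinningSet G W' → ∀ v → W' v → W v)

record RegularSafetyGame (k : ℕ) : Set where
  field
    AV₀ AV₁ AI AB : NFA k
    TE            : Transducer k

game : ∀ {k} → RegularSafetyGame k → PGame k
game G = record
  { V₀ = Lang AV₀ ; V₁ = Lang AV₁ ; I = Lang AI ; B = Lang AB ; E = Rel TE }
  where open RegularSafetyGame G

Vtx : ∀ {k} → RegularSafetyGame k → Word k → Set
Vtx G v = PGame.V₀ (game G) v ⊎ PGame.V₁ (game G) v

IsRegularSafetyGame : ∀ {k} → RegularSafetyGame k → Set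
IsRegularSafetyGame G =
    (∀ v → V₀ v → V₁ v → ⊥)
  × (∀ v u → E v u → Vtx G v × Vtx G u)
  × (∀ v → I v → Vtx G v)
  × (∀ v → B v → Vtx G v)
  where open PGame (game G)

-- Membership oracle: Player 0 wins the finite safety game on the arena
-- restricted to words of length |w|, initial set {w}, bad set
-- {w' ∈ L(A_B) : |w'| = |w|}.  "Player 0 wins" = a winning set exists;
-- the restricted game is finite, so subsets are given by Bool-valued
-- characteristic functions.

finiteGame : ∀ {k} → RegularSafetyGame k → Word k → PGame k
finiteGame G w = record
  { V₀ = λ u → V₀ u × length u ≡ length w
  ; V₁ = λ u → V₁ u × length u ≡ length w
  ; I  = λ u → u ≡ w
  ; B  = λ u → B u × length u ≡ length w
  ; E  = λ v u → E v u × length v ≡ length w × length u ≡ length w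
  }
  where open PGame (game G)

Mem : ∀ {k} → RegularSafetyGame k → Word k → Set
Mem {k} G w = Σ[ W ∈ (Word k → Bool) ] IsWinningSet (finiteGame G w) (λ u → T (W u))

-- L* (Rivest–Schapire): observation table with prefixes S, suffixes E

module _ {k : ℕ} (G : RegularSafetyGame k) where

  RowEq : List (Word k) → Word k → Word k → Set
  RowEq Es u v = All (λ e → Mem G (u ++ e) ⇔ Mem G (v ++ e)) Es

  Closed : List (Word k) → List (Word k) → Set
  Closed S Es = ∀ s → s ∈ S → ∀ a → ∃[ s' ] (s' ∈ S × RowEq Es (s ++ [ a ]) s')

  Consistent : List (Word k) → List (Word k) → Set
  Consistent S Es = ∀ s s' → s ∈ S → s' ∈ S → RowEq Es s s' →
    ∀ a → RowEq Es (s ++ [ a ]) (s' ++ [ a ])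

  -- run of the hypothesis DFA: states are rows of S (represented by
  -- access strings in S), δ(row s, a) = row(s a); from s reading w reaches t
  HReach : List (Word k) → List (Word k) → Word k → Word k → Word k → Set
  HReach S Es s []      t = s ≡ t
  HReach S Es s (a ∷ w) t =
    Σ[ s' ∈ Word k ] (s' ∈ S × RowEq Es (s ++ [ a ]) s' × HReach S Es s' w t)

  -- L(A_H): initial state row(ε), accepting states rows with entry 1 at ε
  Hyp : List (Word k) → List (Word k) → Word k → Set
  Hyp S Es w = Σ[ t ∈ Word k ] (HReach S Es [] w t × Mem G t)

  -- Teacher's equivalence query (cases (a)–(d), in this priority order)
  module Teacher (S Es : List (Word k)) where
    open PGame (game G)
    H : Word k → Set
    H = Hyp S Es

    condA condB condC condD : Set
    condA = ∃[ v ] (I v × ¬ H v)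
    condB = ∃[ v ] (H v × B v)
    condC = ∃[ v ] (V₀ v × H v × (∀ u → E v u → ¬ H u))
    condD = ∃[ v ] (V₁ v × H v × ∃[ u ] (E v u × ¬ H u))

    Cex : Word k → Set
    Cex c =
        (I c × ¬ H c)
      ⊎ ((¬ condA) × H c × B c)
      ⊎ ((¬ condA) × (¬ condB) ×
          ∃[ v ] (V₀ v × H v × (∀ u → E v u → ¬ H u) ×
                   ((Mem G v × E v c × Mem G c) ⊎ (¬ Mem G v × c ≡ v))))
      ⊎ ((¬ condA) × (¬ condB) × (¬ condC) ×
          ∃[ v ] (V₁ v × H v × ∃[ u ] (E v u × ¬ H u) ×
                   ((Mem G v × E v c × ¬ H c) ⊎ (¬ Mem G v × c ≡ v))))

    Yes : Set
    Yes = (¬ condA) × (¬ condB) × (¬ condC) × (¬ condD)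

  -- Rivest–Schapire counterexample analysis: c = u a v with
  -- α_i = Mem(⌊u⌋ a v) ≠ α_{i+1} = Mem(⌊u a⌋ v); the suffix v is added
  Breakpoint : List (Word k) → List (Word k) → Word k → Word k → Set
  Breakpoint S Es c v =
    Σ[ u ∈ Word k ] Σ[ a ∈ Fin k ] Σ[ s ∈ Word k ] Σ[ s' ∈ Word k ]
      ( c ≡ u ++ (a ∷ v)
      × HReach S Es [] u s
      × s' ∈ S × RowEq Es (s ++ [ a ]) s'
      × ¬ (Mem G (s ++ (a ∷ v)) ⇔ Mem G (s' ++ v)))

  data Cfg : Set where
    learning : List (Word k) → List (Word k) → Cfg
    output   : List (Word k) → List (Word k) → Cfg

  initCfg : Cfg
  initCfg = learning [ [] ] [ [] ]

  -- one step; the Bool is true iff the step is an equivalence query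
  data Step : Cfg → Bool → Cfg → Set where
    close   : ∀ {S Es} s a → s ∈ S → (∀ s' → s' ∈ S → ¬ RowEq Es (s ++ [ a ]) s') →
              Step (learning S Es) false (learning (S ++ [ s ++ [ a ] ]) Es)
    consist : ∀ {S Es} s s' a e → s ∈ S → s' ∈ S → RowEq Es s s' → e ∈ Es →
              ¬ (Mem G ((s ++ [ a ]) ++ e) ⇔ Mem G ((s' ++ [ a ]) ++ e)) →
              Step (learning S Es) false (learning S (Es ++ [ a ∷ e ]))
    eq-yes  : ∀ {S Es} → Closed S Es → Consistent S Es → Teacher.Yes S Es →
              Step (learning S Es) true (output S Es)
    eq-cex  : ∀ {S Es} c v → Closed S Es → Consistent S Es → Teacher.Cex S Es c →
              Breakpoint S Es c v →
              Step (learning S Es) true (learning S (Es ++ [ v ]))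

  AnyStep : Cfg → Cfg → Set
  AnyStep c c' = ∃[ b ] Step c b c'

  Reachable : Cfg → Set
  Reachable c = Star AnyStep initCfg c

  -- every run from c terminates (never gets stuck, no infinite run),
  -- using at most n equivalence queries
  data Halts : ℕ → Cfg → Set where
    halted  : ∀ {n S Es} → Halts n (output S Es)
    running : ∀ {n c} →
      (∃[ b ] ∃[ c' ] Step c b c') →
      (∀ {c'} → Step c false c' → Halts n c') →
      (∀ {c'} → Step c true c' → Σ[ m ∈ ℕ ] (n ≡ suc m × Halts m c')) →
      Halts n c

record DFA (k n : ℕ) : Set where
  field
    init  : Fin n
    δ     : Fin n → Fin k → Fin n
    final : Fin n → Bool

DFA-run : ∀ {k n} → DFA k n → Fin n → Word k → Fin n
DFA-run D q []      = q
DFA-run D q (a ∷ w) = DFA-run D (DFA.δ D q a) w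

DFA-accepts : ∀ {k n} → DFA k n → Word k → Set
DFA-accepts D w = T (DFA.final D (DFA-run D (DFA.init D) w))

Recognizes : ∀ {k n} → DFA k n → (Word k → Set) → Set
Recognizes D W = ∀ w → W w ⇔ DFA-accepts D w

MinimalDFAStates : ∀ {k} → (Word k → Set) → ℕ → Set
MinimalDFAStates {k} W n =
  (Σ[ D ∈ DFA k n ] Recognizes D W) × (∀ m (D : DFA k m) → Recognizes D W → n ≤ m)

{-# OPTIONS --safe #-}
module Submission where

-- Soundness: the teacher says "yes" only when none of its checks (a)–(d) fires, and
-- these checks are conditions (1)–(4) of a winning set for the hypothesis language.
-- Player 0 needs an actual successor inside the hypothesis; successors have the same
-- length, so one is found by finite search.
--
-- Completeness: if W is the maximal winning set then Mem w holds iff w ∈ W, because a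
-- winning set of the finite slice game through w can be added to W. So the learner is
-- learning W. The rows of the table are pairwise distinct and stay so, which bounds |S|
-- by the number n of states of any DFA for W (Myhill–Nerode) and rules out
-- inconsistencies. Every counterexample is misclassified by the hypothesis, and its
-- Rivest–Schapire breakpoint is a suffix that makes the table unclosed, so S grows
-- before the next equivalence query: starting from |S| = 1 there are at most n queries.
-- The teacher can always answer because emptiness of regular languages is decidable.

open import Data.Bool using (Bool; true; false; T; not; _∧_)
open import Data.Bool.Properties using (T-∧)
open import Data.Empty using (⊥; ⊥-elim)
open import Data.Fin as Fin using (Fin)
import Data.Fin.Properties as Finₚ
open import Data.List
  using (List; []; _∷_; _++_; [_]; length; lookup; map; filter; foldl; take; drop; allFin; cartesianProductWith)
open import Data.List.Membership.Propositional using (_∈_; find; lose)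
open import Data.List.Membership.Propositional.Properties
  using (∈-++⁺ˡ; ∈-++⁺ʳ; ∈-map⁺; ∈-lookup; ∈-allFin; ∈-cartesianProductWith⁺; ∈-filter⁺; ∈-filter⁻)
import Data.List.Properties as Listₚ
open import Data.List.Relation.Unary.All as All using ([]; _∷_)
import Data.List.Relation.Unary.All.Properties as Allₚ
open import Data.List.Relation.Unary.AllPairs as AllPairs using (AllPairs; []; _∷_)
import Data.List.Relation.Unary.AllPairs.Properties as AllPairsₚ
open import Data.List.Relation.Unary.Any as Any using (here; there)
import Data.List.Relation.Unary.Any.Properties as Anyₚ
open import Data.Nat using (ℕ; zero; suc; _+_; _*_; _∸_; _⊓_; _^_; _≤_; _<_; _≟_; z≤n; s≤s)
open import Data.Nat.Induction using (<-wellFounded)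
import Data.Nat.Properties as ℕₚ
open import Data.Product using (∃; ∃-syntax; Σ-syntax; _×_; _,_; proj₁; proj₂)
open import Data.Product.Function.NonDependent.Propositional using (_×-↣_; _×-⇔_)
open import Data.Sum as Sum using (_⊎_; inj₁; inj₂)
open import Data.Vec as Vec using (Vec)
import Data.Vec.Properties as Vecₚ
open import Function using (_∘_)
open import Function.Bundles using (_⇔_; mk⇔; Equivalence; _↣_; mk↣; Injection)
open import Function.Construct.Composition using (_⇔-∘_; _↣-∘_)
open import Function.Construct.Identity using (⇔-id)
open import Function.Construct.Symmetry using (⇔-sym; ↔-sym)
open import Function.Properties.Inverse using (↔⇒↣)
open import Function.Related.TypeIsomorphisms using (¬-cong-⇔)
open import Induction.WellFounded using (Acc; acc)
open import Relation.Binary.Construct.Closure.ReflexiveTransitive using (Star; ε; _◅_)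
open import Relation.Binary.PropositionalEquality
  using (_≡_; refl; sym; trans; cong; cong₂; subst; module ≡-Reasoning)
open import Relation.Nullary using (¬_; Dec; yes; no; does)
open import Relation.Nullary.Decidable as Dec
  using (⌊_⌋; True; toWitness; fromWitness; decidable-stable; _×-dec_; _⊎-dec_; _→-dec_; ¬?; T?)
open import Relation.Unary using (Decidable)

open import Defs

open Equivalence using (to; from)

private
  variable
    A : Set
    k : ℕ

_⇔-dec_ : {B : Set} → Dec A → Dec B → Dec (A ⇔ B)
a? ⇔-dec b? = Dec.map′ (λ (f , g) → mk⇔ f g) (λ e → to e , from e) ((a? →-dec b?) ×-dec (b? →-dec a?))

True⇔ : (a? : Dec A) → True a? ⇔ A
True⇔ a? = mk⇔ toWitness fromWitness

∃∈? : {P : A → Set} → Decidable P → (xs : List A) → Dec (∃[ x ] (x ∈ xs × P x))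
∃∈? P? xs = Dec.map′ find (λ (_ , x∈xs , px) → lose x∈xs px) (Any.any? P? xs)

∀∈? : {P : A → Set} → Decidable P → (xs : List A) → Dec (∀ x → x ∈ xs → P x)
∀∈? P? xs = Dec.map′ (λ all _ → All.lookup all) (λ all → All.tabulate (all _)) (All.all? P? xs)

sublists : List A → List (List A)
sublists []       = [ [] ]
sublists (x ∷ xs) = map (x ∷_) (sublists xs) ++ sublists xs

filter-∈-sublists : {P : A → Set} (P? : Decidable P) (xs : List A) → filter P? xs ∈ sublists xs
filter-∈-sublists P? []       = here refl
filter-∈-sublists P? (x ∷ xs) with does (P? x)
... | true  = ∈-++⁺ˡ (∈-map⁺ (x ∷_) (filter-∈-sublists P? xs))
... | false = ∈-++⁺ʳ (map (x ∷_) (sublists xs)) (filter-∈-sublists P? xs)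

_≟ʷ_ : (u v : Word k) → Dec (u ≡ v)
_≟ʷ_ = Listₚ.≡-dec Finₚ._≟_

_∈ʷ?_ : (u : Word k) (xs : List (Word k)) → Dec (u ∈ xs)
u ∈ʷ? xs = Any.any? (u ≟ʷ_) xs

wordsOfLength : ℕ → List (Word k)
wordsOfLength         zero    = [ [] ]
wordsOfLength {k = k} (suc n) = cartesianProductWith _∷_ (allFin k) (wordsOfLength n)

∈-wordsOfLength : {n : ℕ} (w : Word k) → length w ≡ n → w ∈ wordsOfLength n
∈-wordsOfLength []      refl = here refl
∈-wordsOfLength (a ∷ w) refl = ∈-cartesianProductWith⁺ _∷_ (∈-allFin a) (∈-wordsOfLength w refl)

NFA-accFrom? : (𝒜 : NFA k) (q : Fin (NFA.nStates 𝒜)) → Decidable (NFA-accFrom 𝒜 q)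
NFA-accFrom? 𝒜 q []      = T? (NFA.final 𝒜 q)
NFA-accFrom? 𝒜 q (a ∷ w) = Finₚ.any? (λ q′ → T? (NFA.δ 𝒜 q a q′) ×-dec NFA-accFrom? 𝒜 q′ w)

Lang? : (𝒜 : NFA k) → Decidable (Lang 𝒜)
Lang? 𝒜 = NFA-accFrom? 𝒜 (NFA.init 𝒜)

Tr-accFrom? : (𝒯 : Transducer k) (q : Fin (Transducer.nStates 𝒯)) (v u : Word k) → Dec (Tr-accFrom 𝒯 q v u)
Tr-accFrom? 𝒯 q []      []      = T? (Transducer.final 𝒯 q)
Tr-accFrom? 𝒯 q []      (_ ∷ _) = no λ ()
Tr-accFrom? 𝒯 q (_ ∷ _) []      = no λ ()
Tr-accFrom? 𝒯 q (a ∷ v) (b ∷ u) =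
  Finₚ.any? (λ q′ → T? (Transducer.δ 𝒯 q a b q′) ×-dec Tr-accFrom? 𝒯 q′ v u)

Rel? : (𝒯 : Transducer k) (v u : Word k) → Dec (Rel 𝒯 v u)
Rel? 𝒯 = Tr-accFrom? 𝒯 (Transducer.init 𝒯)

Tr-accFrom-length : (𝒯 : Transducer k) (q : Fin (Transducer.nStates 𝒯)) (v u : Word k) →
                    Tr-accFrom 𝒯 q v u → length v ≡ length u
Tr-accFrom-length 𝒯 q []      []      _             = refl
Tr-accFrom-length 𝒯 q (_ ∷ v) (_ ∷ u) (q′ , _ , tr) = cong suc (Tr-accFrom-length 𝒯 q′ v u tr)

Rel-length : (𝒯 : Transducer k) (v u : Word k) → Rel 𝒯 v u → length v ≡ length u
Rel-length 𝒯 = Tr-accFrom-length 𝒯 (Transducer.init 𝒯)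

Rel-¬∀¬⇒∃ : (𝒯 : Transducer k) {P : Word k → Set} → Decidable P →
               ∀ v → ¬ (∀ u → Rel 𝒯 v u → ¬ P u) → ∃[ u ] (Rel 𝒯 v u × P u)
Rel-¬∀¬⇒∃ 𝒯 P? v ¬none with ∃∈? (λ u → Rel? 𝒯 v u ×-dec P? u) (wordsOfLength (length v))
... | yes (u , _ , found) = u , found
... | no ¬found = ⊥-elim (¬none λ u e p → ¬found (u , ∈-wordsOfLength u (sym (Rel-length 𝒯 v u e)) , e , p))

module _ (G : PGame k) where
  open PGame G

  IsSafeSet : (Word k → Set) → Set
  IsSafeSet X =
      (∀ v → X v → V₀ v ⊎ V₁ v)
    × (∀ v → B v → X v → ⊥)
    × (∀ v → X v → V₀ v → ∃[ u ] (E v u × X u))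
    × (∀ v → X v → V₁ v → ∀ u → E v u → X u)

  module _ {X : Word k → Set} where

    winning⇒safe : IsWinningSet G X → IsSafeSet X
    winning⇒safe (vtx , _ , safe , some , all) = vtx , safe , some , all

    safe⇒winning : (∀ v → I v → X v) → IsSafeSet X → IsWinningSet G X
    safe⇒winning init (vtx , safe , some , all) = vtx , init , safe , some , all

    IsWinningSet-resp : {Y : Word k → Set} → (∀ v → X v ⇔ Y v) → IsWinningSet G X → IsWinningSet G Y
    IsWinningSet-resp X⇔Y (vtx , init , safe , some , all) =
      (λ v → vtx v ∘ from (X⇔Y v)) ,
      (λ v → to (X⇔Y v) ∘ init v) ,
      (λ v b → safe v b ∘ from (X⇔Y v)) ,
      (λ v y v₀ → let (u , e , x) = some v (from (X⇔Y v) y) v₀ in u , e , to (X⇔Y u) x) ,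
      (λ v y v₁ u e → to (X⇔Y u) (all v (from (X⇔Y v) y) v₁ u e))

    IsSafeSet-∪ : {Y : Word k → Set} → IsSafeSet X → IsSafeSet Y → IsSafeSet (λ v → X v ⊎ Y v)
    IsSafeSet-∪ (vtxˣ , safeˣ , someˣ , allˣ) (vtxʸ , safeʸ , someʸ , allʸ) =
      (λ { v (inj₁ x) → vtxˣ v x ; v (inj₂ y) → vtxʸ v y }) ,
      (λ { v b (inj₁ x) → safeˣ v b x ; v b (inj₂ y) → safeʸ v b y }) ,
      (λ { v (inj₁ x) v₀ → let (u , e , x′) = someˣ v x v₀ in u , e , inj₁ x′
         ; v (inj₂ y) v₀ → let (u , e , y′) = someʸ v y v₀ in u , e , inj₂ y′ }) ,
      (λ { v (inj₁ x) v₁ u e → inj₁ (allˣ v x v₁ u e) ; v (inj₂ y) v₁ u e → inj₂ (allʸ v y v₁ u e) })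

module Slice (G : RegularSafetyGame k) (w : Word k) where
  open RegularSafetyGame G
  open PGame (game G)

  private
    n : ℕ
    n = length w

  module _ {X : Word k → Set} where

    slice-length : IsWinningSet (finiteGame G w) X → ∀ {v} → X v → length v ≡ n
    slice-length (vtx , _) {v} x with vtx v x
    ... | inj₁ (_ , ∣v∣≡n) = ∣v∣≡n
    ... | inj₂ (_ , ∣v∣≡n) = ∣v∣≡n

    slice-winning⇒safe : IsWinningSet (finiteGame G w) X → IsSafeSet (game G) X
    slice-winning⇒safe win@(vtx , _ , safe , some , all) =
      (λ v x → Sum.map proj₁ proj₁ (vtx v x)) ,
      (λ v b x → safe v (b , slice-length win x) x) ,
      (λ v x v₀ → let (u , (e , _) , x′) = some v x (v₀ , slice-length win x) in u , e , x′) ,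
      (λ v x v₁ u e → let ∣v∣≡n = slice-length win x in
        all v x (v₁ , ∣v∣≡n) u (e , ∣v∣≡n , trans (sym (Rel-length TE v u e)) ∣v∣≡n))

    safe⇒slice-winning : IsSafeSet (game G) X → X w →
                         IsWinningSet (finiteGame G w) (λ u → X u × length u ≡ n)
    safe⇒slice-winning (vtx , safe , some , all) xw =
      (λ v (x , ∣v∣≡n) → Sum.map (_, ∣v∣≡n) (_, ∣v∣≡n) (vtx v x)) ,
      (λ { v refl → xw , refl }) ,
      (λ v (b , _) (x , _) → safe v b x) ,
      (λ v (x , ∣v∣≡n) (v₀ , _) → let (u , e , x′) = some v x v₀
                                      ∣u∣≡n = trans (sym (Rel-length TE v u e)) ∣v∣≡n
                                  in u , (e , ∣v∣≡n , ∣u∣≡n) , x′ , ∣u∣≡n) ,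
      (λ v (x , _) (v₁ , _) u (e , _ , ∣u∣≡n) → all v x v₁ u e , ∣u∣≡n)

  slice : List (Word k)
  slice = wordsOfLength n

  winningSublist? : (xs : List (Word k)) → Dec (IsWinningSet (finiteGame G w) (_∈ xs))
  winningSublist? xs =
    ∀∈? (λ v → (Lang? AV₀ v ×-dec length v ≟ n) ⊎-dec (Lang? AV₁ v ×-dec length v ≟ n)) xs
    ×-dec Dec.map′ (λ { w∈xs v refl → w∈xs }) (λ init → init w refl) (w ∈ʷ? xs)
    ×-dec Dec.map′ (λ ok v b v∈xs → ok v v∈xs b) (λ ok v v∈xs b → ok v b v∈xs)
            (∀∈? (λ v → ¬? (Lang? AB v ×-dec length v ≟ n)) xs)
    ×-dec ∀∈? (λ v → (Lang? AV₀ v ×-dec length v ≟ n) →-dec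
                     Dec.map′ (λ (u , u∈xs , e) → u , e , u∈xs) (λ (u , e , u∈xs) → u , u∈xs , e)
                              (∃∈? (edge? v) xs)) xs
    ×-dec ∀∈? (λ v → (Lang? AV₁ v ×-dec length v ≟ n) →-dec
                     Dec.map′ (λ ok u e → ok u (∈-wordsOfLength u (proj₂ (proj₂ e))) e)
                              (λ ok u _ → ok u)
                              (∀∈? (λ u → edge? v u →-dec (u ∈ʷ? xs)) slice)) xs
    where
    edge? : (v u : Word k) → Dec (PGame.E (finiteGame G w) v u)
    edge? v u = Rel? TE v u ×-dec length v ≟ n ×-dec length u ≟ n

  WinningSublistExists : Set
  WinningSublistExists = ∃[ xs ] (xs ∈ sublists slice × IsWinningSet (finiteGame G w) (_∈ xs))

  Mem⇔WinningSublistExists : Mem G w ⇔ WinningSublistExists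
  Mem⇔WinningSublistExists = mk⇔ toSublist fromSublist
    where
    toSublist : Mem G w → WinningSublistExists
    toSublist (f , win) =
      filter (T? ∘ f) slice , filter-∈-sublists (T? ∘ f) slice , IsWinningSet-resp _ T-f⇔∈ win
      where
      T-f⇔∈ : ∀ v → T (f v) ⇔ v ∈ filter (T? ∘ f) slice
      T-f⇔∈ v = mk⇔ (λ t → ∈-filter⁺ (T? ∘ f) (∈-wordsOfLength v (slice-length win t)) t)
                    (proj₂ ∘ ∈-filter⁻ (T? ∘ f) {xs = slice})
    fromSublist : WinningSublistExists → Mem G w
    fromSublist (xs , _ , win) =
      (λ u → ⌊ u ∈ʷ? xs ⌋) , IsWinningSet-resp _ (λ u → ⇔-sym (True⇔ (u ∈ʷ? xs))) win

Mem? : (G : RegularSafetyGame k) → Decidable (Mem G)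
Mem? G w = Dec.map (⇔-sym Mem⇔WinningSublistExists) (∃∈? winningSublist? (sublists slice))
  where open Slice G w

-- The encoding of states is only used to apply the pigeonhole principle.
record FinDFA (k : ℕ) : Set₁ where
  field
    State     : Set
    size      : ℕ
    encoding  : State ↣ Fin size
    start     : State
    step      : State → Fin k → State
    accepting : State → Bool

  run : State → Word k → State
  run = foldl step

  Accepts : Word k → Set
  Accepts w = T (accepting (run start w))

module _ (M : FinDFA k) where
  open FinDFA M

  run-take-drop : ∀ v i j → run start (take i v) ≡ run start (take j v) →
                  run start (take i v ++ drop j v) ≡ run start v
  run-take-drop v i j same = begin
    run start (take i v ++ drop j v)      ≡⟨ Listₚ.foldl-++ step start (take i v) (drop j v) ⟩
    run (run start (take i v)) (drop j v) ≡⟨ cong (λ q → run q (drop j v)) same ⟩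
    run (run start (take j v)) (drop j v) ≡⟨ Listₚ.foldl-++ step start (take j v) (drop j v) ⟨
    run start (take j v ++ drop j v)      ≡⟨ cong (run start) (Listₚ.take++drop≡id j v) ⟩
    run start v                           ∎
    where open ≡-Reasoning

  length-take-drop : ∀ (v : Word k) {i j} → i < j → j ≤ length v → length (take i v ++ drop j v) < length v
  length-take-drop v {i} {j} i<j j≤∣v∣ = begin-strict
    length (take i v ++ drop j v)           ≡⟨ Listₚ.length-++ (take i v) ⟩
    length (take i v) + length (drop j v)   ≡⟨ cong₂ _+_ (Listₚ.length-take i v) (Listₚ.length-drop j v) ⟩
    i ⊓ length v + (length v ∸ j)           ≤⟨ ℕₚ.+-monoˡ-≤ (length v ∸ j) (ℕₚ.m⊓n≤m i (length v)) ⟩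
    i + (length v ∸ j)                      <⟨ ℕₚ.+-monoˡ-< (length v ∸ j) i<j ⟩
    j + (length v ∸ j)                      ≡⟨ ℕₚ.m+[n∸m]≡n j≤∣v∣ ⟩
    length v                                ∎
    where open ℕₚ.≤-Reasoning

  pump-down : ∀ v → size < length v → ∃[ v′ ] (length v′ < length v × run start v′ ≡ run start v)
  pump-down v size<∣v∣ =
    let (i , j , i<j , same) = Finₚ.pigeonhole (ℕₚ.n<1+n size) (Injection.to encoding ∘ stateAfter)
        j≤∣v∣ = ℕₚ.≤-trans (Finₚ.toℕ≤pred[n] j) (ℕₚ.<⇒≤ size<∣v∣)
    in take (Fin.toℕ i) v ++ drop (Fin.toℕ j) v ,
       length-take-drop v i<j j≤∣v∣ ,
       run-take-drop v (Fin.toℕ i) (Fin.toℕ j) (Injection.injective encoding same)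
    where
    stateAfter : Fin (suc size) → State
    stateAfter i = run start (take (Fin.toℕ i) v)

  short-representative : ∀ v → Acc _<_ (length v) → ∃[ v′ ] (length v′ ≤ size × run start v′ ≡ run start v)
  short-representative v (acc shorter) with length v ℕₚ.≤? size
  ... | yes ∣v∣≤size = v , ∣v∣≤size , refl
  ... | no ∣v∣≰size =
    let (v′ , ∣v′∣<∣v∣ , same) = pump-down v (ℕₚ.≰⇒> ∣v∣≰size)
        (v″ , ∣v″∣≤size , same′) = short-representative v′ (shorter ∣v′∣<∣v∣)
    in v″ , ∣v″∣≤size , trans same′ same

  nonEmpty? : Dec (∃ Accepts)
  nonEmpty? = Dec.map′ (λ (_ , _ , v , _ , accepted) → v , accepted) short
    (ℕₚ.anyUpTo? (λ m → ∃∈? (λ v → T? (accepting (run start v))) (wordsOfLength m)) (suc size))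
    where
    short : ∃ Accepts → ∃[ m ] (m < suc size × ∃[ v ] (v ∈ wordsOfLength m × Accepts v))
    short (v , accepts) =
      let (v′ , ∣v′∣≤size , same) = short-representative v (<-wellFounded (length v))
      in length v′ , s≤s ∣v′∣≤size , v′ , ∈-wordsOfLength v′ refl ,
         subst (T ∘ accepting) (sym same) accepts

T-not : ∀ b → T (not b) ⇔ (¬ T b)
T-not true  = mk⇔ (λ ()) (λ ¬t → ¬t _)
T-not false = mk⇔ (λ _ ()) _

T-any?-∧ : ∀ {m} (b c : Fin m → Bool) → T ⌊ Finₚ.any? (λ i → T? (b i ∧ c i)) ⌋ ⇔ (∃[ i ] (T (b i) × T (c i)))
T-any?-∧ b c = mk⇔ (λ (i , t) → i , to T-∧ t) (λ (i , t) → i , from T-∧ t) ⇔-∘ True⇔ (Finₚ.any? _)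

Vec↣Fin : {c m : ℕ} → A ↣ Fin c → Vec A m ↣ Fin (c ^ m)
Vec↣Fin {A = A} {c} e = mk↣ {to = code} code-injective
  where
  code : ∀ {m} → Vec A m → Fin (c ^ m)
  code Vec.[]       = Fin.zero
  code (x Vec.∷ xs) = Fin.combine (Injection.to e x) (code xs)
  code-injective : ∀ {m} {xs ys : Vec A m} → code xs ≡ code ys → xs ≡ ys
  code-injective {xs = Vec.[]}     {Vec.[]}     _  = refl
  code-injective {xs = x Vec.∷ xs} {y Vec.∷ ys} eq =
    let (x≡y , xs≡ys) = Finₚ.combine-injective _ _ _ _ eq
    in cong₂ Vec._∷_ (Injection.injective e x≡y) (code-injective xs≡ys)

complement : FinDFA k → FinDFA k
complement M = record M { accepting = not ∘ FinDFA.accepting M }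

Accepts-complement : (M : FinDFA k) → ∀ w → FinDFA.Accepts (complement M) w ⇔ (¬ FinDFA.Accepts M w)
Accepts-complement M w = T-not _

module _ (M N : FinDFA k) where
  private
    module M = FinDFA M
    module N = FinDFA N

  product : FinDFA k
  product = record
    { State     = M.State × N.State
    ; size      = M.size * N.size
    ; encoding  = ↔⇒↣ (↔-sym Finₚ.*↔×) ↣-∘ (M.encoding ×-↣ N.encoding)
    ; start     = M.start , N.start
    ; step      = λ (p , q) a → M.step p a , N.step q a
    ; accepting = λ (p , q) → M.accepting p ∧ N.accepting q
    }

  run-product : ∀ p q w → FinDFA.run product (p , q) w ≡ (M.run p w , N.run q w)
  run-product p q []      = refl
  run-product p q (a ∷ w) = run-product (M.step p a) (N.step q a) w

  Accepts-product : ∀ w → FinDFA.Accepts product w ⇔ (M.Accepts w × N.Accepts w)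
  Accepts-product w rewrite run-product M.start N.start w = T-∧

module _ (𝒜 : NFA k) where
  open NFA 𝒜

  determinise : FinDFA k
  determinise = record
    { State     = Vec Bool nStates
    ; size      = 2 ^ nStates
    ; encoding  = Vec↣Fin (↔⇒↣ (↔-sym Finₚ.2↔Bool))
    ; start     = Vec.tabulate (λ q → ⌊ q Finₚ.≟ init ⌋)
    ; step      = λ X a → Vec.tabulate (λ q′ → ⌊ Finₚ.any? (λ q → T? (Vec.lookup X q ∧ δ q a q′)) ⌋)
    ; accepting = λ X → ⌊ Finₚ.any? (λ q → T? (Vec.lookup X q ∧ final q)) ⌋
    }

  private
    module D = FinDFA determinise

    T-lookup-tabulate : ∀ (f : Fin nStates → Bool) q → T (Vec.lookup (Vec.tabulate f) q) ⇔ T (f q)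
    T-lookup-tabulate f q =
      subst (λ b → T (Vec.lookup (Vec.tabulate f) q) ⇔ T b) (Vecₚ.lookup∘tabulate f q) (⇔-id _)

  accepting-run : ∀ X w → T (D.accepting (D.run X w)) ⇔ (∃[ q ] (T (Vec.lookup X q) × NFA-accFrom 𝒜 q w))
  accepting-run X []      = T-any?-∧ (Vec.lookup X) final
  accepting-run X (a ∷ w) = mk⇔ forward backward ⇔-∘ accepting-run (D.step X a) w
    where
    successor : ∀ q′ → T (Vec.lookup (D.step X a) q′) ⇔ (∃[ q ] (T (Vec.lookup X q) × T (δ q a q′)))
    successor q′ = T-any?-∧ (Vec.lookup X) (λ q → δ q a q′) ⇔-∘ T-lookup-tabulate _ q′
    forward : ∃[ q′ ] (T (Vec.lookup (D.step X a) q′) × NFA-accFrom 𝒜 q′ w) →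
              ∃[ q ] (T (Vec.lookup X q) × NFA-accFrom 𝒜 q (a ∷ w))
    forward (q′ , q′∈ , accepted) = let (q , q∈X , q→q′) = to (successor q′) q′∈ in
      q , q∈X , q′ , q→q′ , accepted
    backward : ∃[ q ] (T (Vec.lookup X q) × NFA-accFrom 𝒜 q (a ∷ w)) →
               ∃[ q′ ] (T (Vec.lookup (D.step X a) q′) × NFA-accFrom 𝒜 q′ w)
    backward (q , q∈X , q′ , q→q′ , accepted) = q′ , from (successor q′) (q , q∈X , q→q′) , accepted

  Accepts-determinise : ∀ w → D.Accepts w ⇔ Lang 𝒜 w
  Accepts-determinise w = mk⇔ forward backward ⇔-∘ accepting-run D.start w
    where
    T-start : ∀ q → T (Vec.lookup D.start q) ⇔ (q ≡ init)
    T-start q = True⇔ (q Finₚ.≟ init) ⇔-∘ T-lookup-tabulate _ q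
    forward : ∃[ q ] (T (Vec.lookup D.start q) × NFA-accFrom 𝒜 q w) → Lang 𝒜 w
    forward (q , q∈start , accepted) with to (T-start q) q∈start
    ... | refl = accepted
    backward : Lang 𝒜 w → ∃[ q ] (T (Vec.lookup D.start q) × NFA-accFrom 𝒜 q w)
    backward accepted = init , from (T-start init) refl , accepted

module _ (𝒯 : Transducer k) (𝒜 : NFA k) where
  private
    module 𝒯 = Transducer 𝒯
    module 𝒜 = NFA 𝒜

    stateᵀ : Fin (𝒯.nStates * 𝒜.nStates) → Fin 𝒯.nStates
    stateᵀ x = proj₁ (Fin.remQuot {𝒯.nStates} 𝒜.nStates x)

    stateᴬ : Fin (𝒯.nStates * 𝒜.nStates) → Fin 𝒜.nStates
    stateᴬ x = proj₂ (Fin.remQuot {𝒯.nStates} 𝒜.nStates x)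

    readsᵀ : Fin (𝒯.nStates * 𝒜.nStates) → Fin k → Fin (𝒯.nStates * 𝒜.nStates) → Fin k → Bool
    readsᵀ x a y b = 𝒯.δ (stateᵀ x) a b (stateᵀ y)

    readsᴬ : Fin (𝒯.nStates * 𝒜.nStates) → Fin (𝒯.nStates * 𝒜.nStates) → Fin k → Bool
    readsᴬ x y b = 𝒜.δ (stateᴬ x) b (stateᴬ y)

    at-combine : (P : Fin 𝒯.nStates → Fin 𝒜.nStates → Set) → ∀ p q →
                 P p q → P (stateᵀ (Fin.combine p q)) (stateᴬ (Fin.combine p q))
    at-combine P p q = subst (λ (p , q) → P p q) (sym (Finₚ.remQuot-combine p q))

  preimage : NFA k
  preimage = record
    { nStates = 𝒯.nStates * 𝒜.nStates
    ; init    = Fin.combine 𝒯.init 𝒜.init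
    ; δ       = λ x a y → ⌊ Finₚ.any? (λ b → T? (readsᵀ x a y b ∧ readsᴬ x y b)) ⌋
    ; final   = λ x → 𝒯.final (stateᵀ x) ∧ 𝒜.final (stateᴬ x)
    }

  accFrom-preimage : ∀ x v → NFA-accFrom preimage x v ⇔
                     (∃[ u ] (Tr-accFrom 𝒯 (stateᵀ x) v u × NFA-accFrom 𝒜 (stateᴬ x) u))
  accFrom-preimage x [] = mk⇔ (λ t → [] , to T-∧ t) (λ { ([] , t) → from T-∧ t })
  accFrom-preimage x (a ∷ v) = mk⇔ forward backward
    where
    forward : NFA-accFrom preimage x (a ∷ v) →
              ∃[ u ] (Tr-accFrom 𝒯 (stateᵀ x) (a ∷ v) u × NFA-accFrom 𝒜 (stateᴬ x) u)
    forward (y , x→y , accepted) =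
      let (b , x→ᵀy , x→ᴬy) = to (T-any?-∧ (readsᵀ x a y) (readsᴬ x y)) x→y
          (u , tr , accᴬ) = to (accFrom-preimage y v) accepted
      in b ∷ u , (stateᵀ y , x→ᵀy , tr) , (stateᴬ y , x→ᴬy , accᴬ)
    backward : ∃[ u ] (Tr-accFrom 𝒯 (stateᵀ x) (a ∷ v) u × NFA-accFrom 𝒜 (stateᴬ x) u) →
               NFA-accFrom preimage x (a ∷ v)
    backward ([] , () , _)
    backward (b ∷ u , (p , x→ᵀp , tr) , (q , x→ᴬq , accᴬ)) =
      Fin.combine p q ,
      from (T-any?-∧ (readsᵀ x a (Fin.combine p q)) (readsᴬ x (Fin.combine p q)))
        (b , at-combine (λ p q → T (𝒯.δ (stateᵀ x) a b p) × T (𝒜.δ (stateᴬ x) b q)) p q (x→ᵀp , x→ᴬq)) ,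
      from (accFrom-preimage (Fin.combine p q) v)
        (u , at-combine (λ p q → Tr-accFrom 𝒯 p v u × NFA-accFrom 𝒜 q u) p q (tr , accᴬ))

  Lang-preimage : ∀ v → Lang preimage v ⇔ (∃[ u ] (Rel 𝒯 v u × Lang 𝒜 u))
  Lang-preimage v =
    subst (λ (p , q) → Lang preimage v ⇔ (∃[ u ] (Tr-accFrom 𝒯 p v u × NFA-accFrom 𝒜 q u)))
          (Finₚ.remQuot-combine 𝒯.init 𝒜.init)
          (accFrom-preimage (Fin.combine 𝒯.init 𝒜.init) v)

Regular : (Word k → Set) → Set₁
Regular {k} P = Σ[ M ∈ FinDFA k ] (∀ w → P w ⇔ FinDFA.Accepts M w)

module _ {P Q : Word k → Set} where

  Regular-resp : (∀ w → P w ⇔ Q w) → Regular P → Regular Q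
  Regular-resp P⇔Q (M , P⇔M) = M , λ w → P⇔M w ⇔-∘ ⇔-sym (P⇔Q w)

  Regular-× : Regular P → Regular Q → Regular (λ w → P w × Q w)
  Regular-× (M , P⇔M) (N , Q⇔N) = product M N , λ w → ⇔-sym (Accepts-product M N w) ⇔-∘ (P⇔M w ×-⇔ Q⇔N w)

Regular-¬ : {P : Word k → Set} → Regular P → Regular (¬_ ∘ P)
Regular-¬ (M , P⇔M) = complement M , λ w → ⇔-sym (Accepts-complement M w) ⇔-∘ ¬-cong-⇔ (P⇔M w)

Lang-regular : (𝒜 : NFA k) → Regular (Lang 𝒜)
Lang-regular 𝒜 = determinise 𝒜 , λ w → ⇔-sym (Accepts-determinise 𝒜 w)

Regular-∃? : {P : Word k → Set} → Regular P → Dec (∃ P)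
Regular-∃? (M , P⇔M) = Dec.map′ (λ (w , accepted) → w , from (P⇔M w) accepted)
                                (λ (w , p) → w , to (P⇔M w) p) (nonEmpty? M)

module Table (G : RegularSafetyGame k) where

  RowEq? : ∀ Es u v → Dec (RowEq G Es u v)
  RowEq? Es u v = All.all? (λ e → Mem? G (u ++ e) ⇔-dec Mem? G (v ++ e)) Es

  module _ {Es : List (Word k)} where

    RowEq-refl : ∀ u → RowEq G Es u u
    RowEq-refl u = All.universal (λ _ → ⇔-id _) Es

    RowEq-sym : ∀ {u v} → RowEq G Es u v → RowEq G Es v u
    RowEq-sym = All.map ⇔-sym

    RowEq-trans : ∀ {u v w} → RowEq G Es u v → RowEq G Es v w → RowEq G Es u w
    RowEq-trans r r′ = All.zipWith (λ (e , e′) → e′ ⇔-∘ e) (r , r′)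

  DistinctRows : List (Word k) → List (Word k) → Set
  DistinctRows Es S = AllPairs (λ s s′ → ¬ RowEq G Es s s′) S

  module _ {Es : List (Word k)} where

    DistinctRows⇒≡ : ∀ {S s s′} → DistinctRows Es S → s ∈ S → s′ ∈ S → RowEq G Es s s′ → s ≡ s′
    DistinctRows⇒≡ (_      ∷ _)        (here refl) (here refl)   _ = refl
    DistinctRows⇒≡ (fresh ∷ _)         (here refl) (there s′∈S) r = ⊥-elim (All.lookup fresh s′∈S r)
    DistinctRows⇒≡ (fresh ∷ _)         (there s∈S) (here refl)  r = ⊥-elim (All.lookup fresh s∈S (RowEq-sym r))
    DistinctRows⇒≡ (_      ∷ distinct) (there s∈S) (there s′∈S) r = DistinctRows⇒≡ distinct s∈S s′∈S r

    DistinctRows-∷ʳ : ∀ {S x} → DistinctRows Es S → (∀ s → s ∈ S → ¬ RowEq G Es x s) →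
                      DistinctRows Es (S ++ [ x ])
    DistinctRows-∷ʳ distinct fresh =
      AllPairsₚ.++⁺ distinct ([] ∷ []) (All.tabulate λ s∈S → (λ r → fresh _ s∈S (RowEq-sym r)) ∷ [])

    DistinctRows-lookup : ∀ {S} → DistinctRows Es S → ∀ {i j} → i Fin.< j → ¬ RowEq G Es (lookup S i) (lookup S j)
    DistinctRows-lookup {_ ∷ S} (fresh ∷ _) {Fin.zero} {Fin.suc j} _ = All.lookup fresh (∈-lookup j)
    DistinctRows-lookup {_ ∷ S} (_ ∷ distinct) {Fin.suc i} {Fin.suc j} (s≤s i<j) = DistinctRows-lookup distinct i<j

  DistinctRows-extend : ∀ {Es S} v → DistinctRows Es S → DistinctRows (Es ++ [ v ]) S
  DistinctRows-extend {Es} v = AllPairs.map (λ ¬r r → ¬r (Allₚ.++⁻ˡ Es r))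

  DistinctRows⇒Consistent : ∀ {S Es} → DistinctRows Es S → Consistent G S Es
  DistinctRows⇒Consistent distinct s s′ s∈S s′∈S r a with DistinctRows⇒≡ distinct s∈S s′∈S r
  ... | refl = RowEq-refl (s ++ [ a ])

  Unclosed : List (Word k) → List (Word k) → Set
  Unclosed S Es = ∃[ s ] ∃[ a ] (s ∈ S × (∀ s′ → s′ ∈ S → ¬ RowEq G Es (s ++ [ a ]) s′))

  closed-or-unclosed : ∀ S Es → Closed G S Es ⊎ Unclosed S Es
  closed-or-unclosed S Es with ∃∈? (λ s → Finₚ.any? (λ a → ∀∈? (λ s′ → ¬? (RowEq? Es (s ++ [ a ]) s′)) S)) S
  ... | yes (s , s∈S , a , fresh) = inj₂ (s , a , s∈S , fresh)
  ... | no ¬unclosed = inj₁ λ s s∈S a → decidable-stable (∃∈? (RowEq? Es (s ++ [ a ])) S)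
                                          λ ¬∃ → ¬unclosed (s , s∈S , a , λ s′ s′∈S r → ¬∃ (s′ , s′∈S , r))

  Mismatch : List (Word k) → List (Word k) → Word k → Set
  Mismatch S Es c = (Mem G c × ¬ Hyp G S Es c) ⊎ (Hyp G S Es c × ¬ Mem G c)

  module _ {S Es : List (Word k)} where

    HReach-total : Closed G S Es → ∀ {s} → s ∈ S → ∀ w → ∃[ t ] HReach G S Es s w t
    HReach-total closed {s} s∈S []      = s , refl
    HReach-total closed s∈S (a ∷ w) =
      let (s′ , s′∈S , r) = closed _ s∈S a
          (t , run) = HReach-total closed s′∈S w
      in t , s′ , s′∈S , r , run

    HReach-∈ : ∀ {s} w {t} → s ∈ S → HReach G S Es s w t → t ∈ S
    HReach-∈ []      s∈S refl                 = s∈S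
    HReach-∈ (a ∷ w) _   (_ , s′∈S , _ , run) = HReach-∈ w s′∈S run

    HReach-∷ʳ : ∀ {s} w {t t′ a} → HReach G S Es s w t → t′ ∈ S → RowEq G Es (t ++ [ a ]) t′ →
                HReach G S Es s (w ++ [ a ]) t′
    HReach-∷ʳ []      refl                     t′∈S r = _ , t′∈S , r , refl
    HReach-∷ʳ (b ∷ w) (s′ , s′∈S , r′ , run) t′∈S r = s′ , s′∈S , r′ , HReach-∷ʳ w run t′∈S r

    HReach-functional : DistinctRows Es S → ∀ {s} w {t t′} → HReach G S Es s w t → HReach G S Es s w t′ → t ≡ t′
    HReach-functional distinct []      refl refl = refl
    HReach-functional distinct (a ∷ w) (s₁ , s₁∈S , r₁ , run₁) (s₂ , s₂∈S , r₂ , run₂)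
      with DistinctRows⇒≡ distinct s₁∈S s₂∈S (RowEq-trans (RowEq-sym r₁) r₂)
    ... | refl = HReach-functional distinct w run₁ run₂

    -- Reading c, the membership of (reached access string) ++ (rest of c) starts as
    -- Mem c and ends as the hypothesis' verdict; the first change is a breakpoint.
    breakpoint-search : ∀ p {s} w {t} → HReach G S Es [] p s → HReach G S Es s w t →
                        ¬ (Mem G (s ++ w) ⇔ Mem G t) → ∃[ v ] Breakpoint G S Es (p ++ w) v
    breakpoint-search p {s} [] {t} _ refl differ =
      ⊥-elim (differ (subst (λ x → Mem G x ⇔ Mem G s) (sym (Listₚ.++-identityʳ s)) (⇔-id _)))
    breakpoint-search p {s} (a ∷ w) reach (s′ , s′∈S , r , run) differ
      with Mem? G (s ++ a ∷ w) ⇔-dec Mem? G (s′ ++ w)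
    ... | no differs-here = w , p , a , s , s′ , refl , reach , s′∈S , r , differs-here
    ... | yes same =
      let (v , bp) = breakpoint-search (p ++ [ a ]) w (HReach-∷ʳ p reach s′∈S r) run (λ e → differ (e ⇔-∘ same))
      in v , subst (λ c → Breakpoint G S Es c v) (Listₚ.++-assoc p [ a ] w) bp

    mismatch⇒breakpoint : Closed G S Es → [] ∈ S → ∀ {c} → Mismatch S Es c → ∃[ v ] Breakpoint G S Es c v
    mismatch⇒breakpoint closed ε∈S {c} (inj₁ (mem , ¬hyp)) =
      let (t , run) = HReach-total closed ε∈S c
      in breakpoint-search [] c refl run (λ e → ¬hyp (t , run , to e mem))
    mismatch⇒breakpoint closed ε∈S {c} (inj₂ ((t , run , memₜ) , ¬mem)) =
      breakpoint-search [] c refl run (λ e → ¬mem (from e memₜ))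

    -- s′ is the only row of S equal to that of s ++ [ a ] on Es, and the new suffix separates them.
    breakpoint⇒unclosed : DistinctRows Es S → [] ∈ S → ∀ {c v} → Breakpoint G S Es c v → ¬ Closed G S (Es ++ [ v ])
    breakpoint⇒unclosed distinct ε∈S {v = v} (u , a , s , s′ , _ , reach , s′∈S , r , differ) closed′
      with closed′ s (HReach-∈ u ε∈S reach) a
    ... | s″ , s″∈S , r″
      with DistinctRows⇒≡ distinct s′∈S s″∈S (RowEq-trans (RowEq-sym r) (Allₚ.++⁻ˡ Es r″))
    ... | refl with Allₚ.++⁻ʳ Es r″
    ... | same ∷ [] = differ (subst (λ x → Mem G x ⇔ Mem G (s′ ++ v)) (Listₚ.++-assoc s [ a ] v) same)

  module Hypothesis (S Es : List (Word k)) (ε∈S : [] ∈ S) where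

    hypothesisNFA : {Q : Word k → Set} → Decidable Q → NFA k
    hypothesisNFA Q? = record
      { nStates = length S
      ; init    = Any.index ε∈S
      ; δ       = λ i a j → ⌊ RowEq? Es (lookup S i ++ [ a ]) (lookup S j) ⌋
      ; final   = λ i → ⌊ Q? (lookup S i) ⌋
      }

    module _ {Q : Word k → Set} (Q? : Decidable Q) where

      accFrom-hypothesisNFA : ∀ i w → NFA-accFrom (hypothesisNFA Q?) i w ⇔
                                      (∃[ t ] (HReach G S Es (lookup S i) w t × Q t))
      accFrom-hypothesisNFA i [] = mk⇔ (λ q → _ , refl , toWitness q) (λ { (_ , refl , q) → fromWitness q })
      accFrom-hypothesisNFA i (a ∷ w) = mk⇔ forward backward
        where
        forward : NFA-accFrom (hypothesisNFA Q?) i (a ∷ w) → ∃[ t ] (HReach G S Es (lookup S i) (a ∷ w) t × Q t)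
        forward (j , r , accepted) =
          let (t , run , q) = to (accFrom-hypothesisNFA j w) accepted
          in t , (lookup S j , ∈-lookup j , toWitness r , run) , q
        backward : ∃[ t ] (HReach G S Es (lookup S i) (a ∷ w) t × Q t) → NFA-accFrom (hypothesisNFA Q?) i (a ∷ w)
        backward (t , (s′ , s′∈S , r , run) , q) with Any.index s′∈S | Anyₚ.lookup-index s′∈S
        ... | j | refl = j , fromWitness r , from (accFrom-hypothesisNFA j w) (t , run , q)

      Lang-hypothesisNFA : ∀ w → Lang (hypothesisNFA Q?) w ⇔ (∃[ t ] (HReach G S Es [] w t × Q t))
      Lang-hypothesisNFA w =
        subst (λ s → Lang (hypothesisNFA Q?) w ⇔ (∃[ t ] (HReach G S Es s w t × Q t)))
              (sym (Anyₚ.lookup-index ε∈S)) (accFrom-hypothesisNFA (Any.index ε∈S) w)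

    Hyp? : Decidable (Hyp G S Es)
    Hyp? w = Dec.map (Lang-hypothesisNFA (Mem? G) w) (Lang? (hypothesisNFA (Mem? G)) w)

module Soundness (G : RegularSafetyGame k) (wf : IsRegularSafetyGame G) where
  open RegularSafetyGame G
  open PGame (game G)
  open Table G

  ReachableInvariant : Cfg G → Set
  ReachableInvariant (learning S Es) = [] ∈ S
  ReachableInvariant (output S Es)   = [] ∈ S × Teacher.Yes G S Es

  step-invariant : ∀ {c b c′} → Step G c b c′ → ReachableInvariant c → ReachableInvariant c′
  step-invariant (close _ _ _ _)             ε∈S = ∈-++⁺ˡ ε∈S
  step-invariant (consist _ _ _ _ _ _ _ _ _) ε∈S = ε∈S
  step-invariant (eq-yes _ _ answered)       ε∈S = ε∈S , answered
  step-invariant (eq-cex _ _ _ _ _ _)        ε∈S = ε∈S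

  invariant-along : ∀ {c c′} → Star (AnyStep G) c c′ → ReachableInvariant c → ReachableInvariant c′
  invariant-along ε                   inv = inv
  invariant-along ((_ , step) ◅ steps) inv = invariant-along steps (step-invariant step inv)

  yes⇒winning : ∀ {S Es} → [] ∈ S → Teacher.Yes G S Es →
                IsWinningSet (game G) (λ w → Hyp G S Es w × Vtx G w)
  yes⇒winning {S} {Es} ε∈S (¬a , ¬b , ¬c , ¬d) =
    (λ v (_ , vtx) → vtx) ,
    (λ v i → decidable-stable (Hyp? v) (λ ¬h → ¬a (v , i , ¬h)) , I⊆V v i) ,
    (λ v b (h , _) → ¬b (v , h , b)) ,
    (λ v (h , _) v₀ → let (u , e , hᵤ) = Rel-¬∀¬⇒∃ TE Hyp? v (λ none → ¬c (v , v₀ , h , none))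
                      in u , e , hᵤ , proj₂ (E⊆V×V v u e)) ,
    (λ v (h , _) v₁ u e → decidable-stable (Hyp? u) (λ ¬hᵤ → ¬d (v , v₁ , h , u , e , ¬hᵤ)) ,
                          proj₂ (E⊆V×V v u e))
    where
    open Hypothesis S Es ε∈S
    E⊆V×V : ∀ v u → E v u → Vtx G v × Vtx G u
    E⊆V×V = proj₁ (proj₂ wf)
    I⊆V : ∀ v → I v → Vtx G v
    I⊆V = proj₁ (proj₂ (proj₂ wf))

  soundness : ∀ S Es → Reachable G (output S Es) → IsWinningSet (game G) (λ w → Hyp G S Es w × Vtx G w)
  soundness S Es reachable =
    let (ε∈S , answered) = invariant-along reachable (here refl) in yes⇒winning ε∈S answered

module Completeness (G : RegularSafetyGame k) (W : Word k → Set) (maxW : IsMaximalWinningSet (game G) W)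
                    {n : ℕ} (D : DFA k n) (D-recognises : Recognizes D W) where
  open RegularSafetyGame G
  open PGame (game G)
  open Table G

  private
    W-winning : IsWinningSet (game G) W
    W-winning = proj₁ maxW

    W-safe : IsSafeSet (game G) W
    W-safe = winning⇒safe (game G) W-winning

    W-init : ∀ v → I v → W v
    W-init = proj₁ (proj₂ W-winning)

    W-avoids-B : ∀ v → B v → W v → ⊥
    W-avoids-B = proj₁ (proj₂ W-safe)

    W-some-successor : ∀ v → W v → V₀ v → ∃[ u ] (E v u × W u)
    W-some-successor = proj₁ (proj₂ (proj₂ W-safe))

    W-all-successors : ∀ v → W v → V₁ v → ∀ u → E v u → W u
    W-all-successors = proj₂ (proj₂ (proj₂ W-safe))

  W? : Decidable W
  W? w = Dec.map (⇔-sym (D-recognises w)) (T? _)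

  Mem⇒W : ∀ {w} → Mem G w → W w
  Mem⇒W {w} (f , win) = proj₂ maxW (λ v → W v ⊎ T (f v)) W∪f-winning w (inj₂ (proj₁ (proj₂ win) w refl))
    where
    open Slice G w
    W∪f-winning : IsWinningSet (game G) (λ v → W v ⊎ T (f v))
    W∪f-winning = safe⇒winning (game G) (λ v → inj₁ ∘ W-init v)
                                        (IsSafeSet-∪ (game G) W-safe (slice-winning⇒safe win))

  W⇒Mem : ∀ {w} → W w → Mem G w
  W⇒Mem {w} w∈W = (λ u → ⌊ W? u ×-dec length u ≟ length w ⌋) ,
                  IsWinningSet-resp (finiteGame G w) (λ u → ⇔-sym (True⇔ _)) (safe⇒slice-winning W-safe w∈W)
    where open Slice G w

  Mem⇔W : ∀ w → Mem G w ⇔ W w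
  Mem⇔W w = mk⇔ Mem⇒W W⇒Mem

  runD : Word k → Fin n
  runD = DFA-run D (DFA.init D)

  DFA-run-++ : ∀ q u v → DFA-run D q (u ++ v) ≡ DFA-run D (DFA-run D q u) v
  DFA-run-++ q []      v = refl
  DFA-run-++ q (a ∷ u) v = DFA-run-++ (DFA.δ D q a) u v

  Mem-++⇔final : ∀ s e → Mem G (s ++ e) ⇔ T (DFA.final D (DFA-run D (runD s) e))
  Mem-++⇔final s e = subst (λ q → Mem G (s ++ e) ⇔ T (DFA.final D q)) (DFA-run-++ (DFA.init D) s e)
                           (D-recognises (s ++ e) ⇔-∘ Mem⇔W (s ++ e))

  sameState⇒RowEq : ∀ Es {s s′} → runD s ≡ runD s′ → RowEq G Es s s′
  sameState⇒RowEq Es {s} {s′} same = All.universal row Es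
    where
    row : ∀ e → Mem G (s ++ e) ⇔ Mem G (s′ ++ e)
    row e = ⇔-sym (Mem-++⇔final s′ e) ⇔-∘
            subst (λ q → Mem G (s ++ e) ⇔ T (DFA.final D (DFA-run D q e))) same (Mem-++⇔final s e)

  DistinctRows-length≤ : ∀ {Es S} → DistinctRows Es S → length S ≤ n
  DistinctRows-length≤ {Es} {S} distinct with length S ℕₚ.≤? n
  ... | yes ∣S∣≤n = ∣S∣≤n
  ... | no ∣S∣≰n =
    let (i , j , i<j , same) = Finₚ.pigeonhole (ℕₚ.≰⇒> ∣S∣≰n) (runD ∘ lookup S)
    in ⊥-elim (DistinctRows-lookup distinct i<j (sameState⇒RowEq Es same))

  record Invariant (S Es : List (Word k)) : Set where
    field
      ε∈S      : [] ∈ S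
      distinct : DistinctRows Es S

  module EquivalenceQuery {S Es : List (Word k)} (inv : Invariant S Es) (closed : Closed G S Es) where
    open Invariant inv
    open Hypothesis S Es ε∈S
    open Teacher G S Es

    -- The hypothesis is deterministic and total here, so flipping its accepting rows
    -- gives an NFA for the complement, as needed for the preimage in condition (d).
    ¬H⇔ : ∀ w → (¬ H w) ⇔ (∃[ t ] (HReach G S Es [] w t × ¬ Mem G t))
    ¬H⇔ w = mk⇔ forward backward
      where
      forward : ¬ H w → ∃[ t ] (HReach G S Es [] w t × ¬ Mem G t)
      forward ¬h = let (t , run) = HReach-total closed ε∈S w in t , run , λ m → ¬h (t , run , m)
      backward : ∃[ t ] (HReach G S Es [] w t × ¬ Mem G t) → ¬ H w
      backward (t , run , ¬m) (t′ , run′ , m′) with HReach-functional distinct w run run′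
      ... | refl = ¬m m′

    H-regular : Regular H
    H-regular = Regular-resp (Lang-hypothesisNFA (Mem? G)) (Lang-regular (hypothesisNFA (Mem? G)))

    no-successor-in-H-regular : Regular (λ v → ∀ u → E v u → ¬ H u)
    no-successor-in-H-regular = Regular-resp equiv (Regular-¬ (Lang-regular preNFA))
      where
      hypNFA : NFA k
      hypNFA = hypothesisNFA (Mem? G)
      preNFA : NFA k
      preNFA = preimage TE hypNFA
      pre⇔ : ∀ v → Lang preNFA v ⇔ (∃[ u ] (E v u × H u))
      pre⇔ v = mk⇔ (λ (u , e , h) → u , e , to (Lang-hypothesisNFA (Mem? G) u) h)
                   (λ (u , e , h) → u , e , from (Lang-hypothesisNFA (Mem? G) u) h)
               ⇔-∘ Lang-preimage TE hypNFA v
      equiv : ∀ v → (¬ Lang preNFA v) ⇔ (∀ u → E v u → ¬ H u)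
      equiv v = mk⇔ (λ ¬pre u e h → ¬pre (from (pre⇔ v) (u , e , h)))
                    (λ none pre → let (u , e , h) = to (pre⇔ v) pre in none u e h)

    successor-outside-H-regular : Regular (λ v → ∃[ u ] (E v u × ¬ H u))
    successor-outside-H-regular = Regular-resp pre⇔ (Lang-regular preNFA)
      where
      hypNFA : NFA k
      hypNFA = hypothesisNFA (¬? ∘ Mem? G)
      preNFA : NFA k
      preNFA = preimage TE hypNFA
      pre⇔ : ∀ v → Lang preNFA v ⇔ (∃[ u ] (E v u × ¬ H u))
      pre⇔ v = mk⇔ (λ (u , e , ¬h) → u , e , from (¬H⇔ u) (to (Lang-hypothesisNFA (¬? ∘ Mem? G) u) ¬h))
                   (λ (u , e , ¬h) → u , e , from (Lang-hypothesisNFA (¬? ∘ Mem? G) u) (to (¬H⇔ u) ¬h))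
               ⇔-∘ Lang-preimage TE hypNFA v

    condA? : Dec condA
    condA? = Regular-∃? (Regular-× (Lang-regular AI) (Regular-¬ H-regular))

    condB? : Dec condB
    condB? = Regular-∃? (Regular-× H-regular (Lang-regular AB))

    condC? : Dec condC
    condC? = Regular-∃? (Regular-× (Lang-regular AV₀) (Regular-× H-regular no-successor-in-H-regular))

    condD? : Dec condD
    condD? = Regular-∃? (Regular-× (Lang-regular AV₁) (Regular-× H-regular successor-outside-H-regular))

    MisclassifiedCex : Set
    MisclassifiedCex = ∃[ c ] (Cex c × Mismatch S Es c)

    Answer : Set
    Answer = Yes ⊎ MisclassifiedCex

    counterexampleC : ¬ condA → ¬ condB → condC → MisclassifiedCex
    counterexampleC ¬a ¬b (v , v₀ , h , none) = from-Mem? (Mem? G v)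
      where
      from-Mem? : Dec (Mem G v) → MisclassifiedCex
      from-Mem? (yes m) = let (u , e , u∈W) = W-some-successor v (Mem⇒W m) v₀ in
        u , inj₂ (inj₂ (inj₁ (¬a , ¬b , v , v₀ , h , none , inj₁ (m , e , W⇒Mem u∈W)))) ,
        inj₁ (W⇒Mem u∈W , none u e)
      from-Mem? (no ¬m) =
        v , inj₂ (inj₂ (inj₁ (¬a , ¬b , v , v₀ , h , none , inj₂ (¬m , refl)))) , inj₂ (h , ¬m)

    counterexampleD : ¬ condA → ¬ condB → ¬ condC → condD → MisclassifiedCex
    counterexampleD ¬a ¬b ¬c (v , v₁ , h , u , e , ¬hᵤ) = from-Mem? (Mem? G v)
      where
      from-Mem? : Dec (Mem G v) → MisclassifiedCex
      from-Mem? (yes m) =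
        u , inj₂ (inj₂ (inj₂ (¬a , ¬b , ¬c , v , v₁ , h , u , (e , ¬hᵤ) , inj₁ (m , e , ¬hᵤ)))) ,
        inj₁ (W⇒Mem (W-all-successors v (Mem⇒W m) v₁ u e) , ¬hᵤ)
      from-Mem? (no ¬m) =
        v , inj₂ (inj₂ (inj₂ (¬a , ¬b , ¬c , v , v₁ , h , u , (e , ¬hᵤ) , inj₂ (¬m , refl)))) , inj₂ (h , ¬m)

    answer-from : Dec condA → Dec condB → Dec condC → Dec condD → Answer
    answer-from (yes (v , i , ¬h)) _ _ _ = inj₂ (v , inj₁ (i , ¬h) , inj₁ (W⇒Mem (W-init v i) , ¬h))
    answer-from (no ¬a) (yes (v , h , b)) _ _ =
      inj₂ (v , inj₂ (inj₁ (¬a , h , b)) , inj₂ (h , W-avoids-B v b ∘ Mem⇒W))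
    answer-from (no ¬a) (no ¬b) (yes c) _       = inj₂ (counterexampleC ¬a ¬b c)
    answer-from (no ¬a) (no ¬b) (no ¬c) (yes d) = inj₂ (counterexampleD ¬a ¬b ¬c d)
    answer-from (no ¬a) (no ¬b) (no ¬c) (no ¬d) = inj₁ (¬a , ¬b , ¬c , ¬d)

    query-step-from : Answer → ∃[ c′ ] Step G (learning S Es) true c′
    query-step-from (inj₁ yes-answer) = _ , eq-yes closed (DistinctRows⇒Consistent distinct) yes-answer
    query-step-from (inj₂ (c , cex , mismatch)) =
      let (v , bp) = mismatch⇒breakpoint closed ε∈S mismatch
      in _ , eq-cex c v closed (DistinctRows⇒Consistent distinct) cex bp

    query-step : ∃[ c′ ] Step G (learning S Es) true c′
    query-step = query-step-from (answer-from condA? condB? condC? condD?)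

  open Invariant

  progress : ∀ {S Es} → Invariant S Es → ∃[ b ] ∃[ c′ ] Step G (learning S Es) b c′
  progress {S} {Es} inv = from-closedness (closed-or-unclosed S Es)
    where
    from-closedness : Closed G S Es ⊎ Unclosed S Es → ∃[ b ] ∃[ c′ ] Step G (learning S Es) b c′
    from-closedness (inj₁ closed)                 = true , EquivalenceQuery.query-step inv closed
    from-closedness (inj₂ (s , a , s∈S , fresh)) = false , _ , close s a s∈S fresh

  close-invariant : ∀ {S Es s a} → Invariant S Es → (∀ s′ → s′ ∈ S → ¬ RowEq G Es (s ++ [ a ]) s′) →
                    Invariant (S ++ [ s ++ [ a ] ]) Es
  close-invariant inv fresh = record { ε∈S = ∈-++⁺ˡ (ε∈S inv) ; distinct = DistinctRows-∷ʳ (distinct inv) fresh }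

  extend-invariant : ∀ {S Es} v → Invariant S Es → Invariant S (Es ++ [ v ])
  extend-invariant v inv = record { ε∈S = ε∈S inv ; distinct = DistinctRows-extend v (distinct inv) }

  length-∷ʳ : (S : List (Word k)) (x : Word k) → length (S ++ [ x ]) ≡ suc (length S)
  length-∷ʳ S x = trans (Listₚ.length-++ S) (ℕₚ.+-comm (length S) 1)

  fuel-after-close : ∀ S x f → length S + suc f ≡ n → length (S ++ [ x ]) + f ≡ n
  fuel-after-close S x f fuel = trans (cong (_+ f) (length-∷ʳ S x)) (trans (sym (ℕₚ.+-suc (length S) f)) fuel)

  bound-after-close : ∀ m S x → n ≤ m + length S → n < m + length (S ++ [ x ])
  bound-after-close m S x bound =
    subst (n <_) (sym (trans (cong (m +_) (length-∷ʳ S x)) (ℕₚ.+-suc m (length S)))) (s≤s bound)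

  no-fuel-no-close : ∀ {S Es} x → length S + 0 ≡ n → ¬ Invariant (S ++ [ x ]) Es
  no-fuel-no-close {S} x fuel inv =
    ℕₚ.<-irrefl (trans (sym (ℕₚ.+-identityʳ (length S))) fuel)
               (subst (_≤ n) (length-∷ʳ S x) (DistinctRows-length≤ (distinct inv)))

  -- m is the number of equivalence queries still allowed and f the number of rows that
  -- can still be added. A counterexample costs a query but leaves the table unclosed,
  -- and closing it adds a row; this keeps n < m + |S| whenever a query is possible.
  halts : ∀ m f {S Es} → Invariant S Es → length S + f ≡ n → n < m + length S → Halts G m (learning S Es)
  halts-unclosed : ∀ m f {S Es} → Invariant S Es → ¬ Closed G S Es → length S + f ≡ n → n ≤ m + length S →
                   Halts G m (learning S Es)
  halts-after-table-step : ∀ m f {S Es} → Invariant S Es → length S + f ≡ n → n ≤ m + length S →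
                           ∀ {c′} → Step G (learning S Es) false c′ → Halts G m c′

  halts zero    f inv _ n<∣S∣ = ⊥-elim (ℕₚ.<⇒≱ n<∣S∣ (DistinctRows-length≤ (distinct inv)))
  halts (suc m) f {S} inv fuel bound =
    running (progress inv) (halts-after-table-step (suc m) f inv fuel (ℕₚ.<⇒≤ bound)) after-query
    where
    after-query : ∀ {c′} → Step G (learning S _) true c′ → Σ[ m′ ∈ ℕ ] (suc m ≡ suc m′ × Halts G m′ c′)
    after-query (eq-yes _ _ _)             = m , refl , halted
    after-query (eq-cex _ v closed _ _ bp) =
      m , refl , halts-unclosed m f (extend-invariant v inv) (breakpoint⇒unclosed (distinct inv) (ε∈S inv) bp)
                                fuel (ℕₚ.≤-pred bound)

  halts-unclosed m f inv unclosed fuel bound =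
    running (progress inv) (halts-after-table-step m f inv fuel bound) after-query
    where
    after-query : ∀ {c′} → Step G (learning _ _) true c′ → Σ[ m′ ∈ ℕ ] (m ≡ suc m′ × Halts G m′ c′)
    after-query (eq-yes closed _ _)       = ⊥-elim (unclosed closed)
    after-query (eq-cex _ _ closed _ _ _) = ⊥-elim (unclosed closed)

  halts-after-table-step m f inv fuel bound (consist s s′ a e s∈S s′∈S r e∈Es inconsistent) =
    ⊥-elim (inconsistent (All.lookup (DistinctRows⇒Consistent (distinct inv) s s′ s∈S s′∈S r a) e∈Es))
  halts-after-table-step m zero inv fuel _ (close s a _ fresh) =
    ⊥-elim (no-fuel-no-close (s ++ [ a ]) fuel (close-invariant inv fresh))
  halts-after-table-step m (suc f) {S} inv fuel bound (close s a _ fresh) =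
    halts m f (close-invariant inv fresh) (fuel-after-close S _ f fuel) (bound-after-close m S _ bound)

  completeness : Halts G n (initCfg G)
  completeness =
    halts n (n ∸ 1) initial-invariant (ℕₚ.m+[n∸m]≡n (DistinctRows-length≤ (distinct initial-invariant)))
          (ℕₚ.m<m+n n (s≤s z≤n))
    where
    initial-invariant : Invariant [ [] ] [ [] ]
    initial-invariant = record { ε∈S = here refl ; distinct = [] ∷ [] }

-- The bound holds for every DFA recognising W.
mainTheorem2 : ∀ {k : ℕ} (G : RegularSafetyGame k) → IsRegularSafetyGame G →
    (∀ S Es → Reachable G (output S Es) →
      IsWinningSet (game G) (λ w → Hyp G S Es w × Vtx G w))
    × (∀ (W : Word k → Set) → IsMaximalWinningSet (game G) W →
      ∀ n → MinimalDFAStates W n → Halts G n (initCfg G))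
mainTheorem2 G wf =
  Soundness.soundness G wf ,
  λ W maxW n ((D , D-recognises) , _) → Completeness.completeness G W maxW D D-recognises
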